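{- Let $\Delta\in\mathcal M_{N,M}$ with skeleton parts $S_0,\dots,S_{d-1}$, let $b_{ij}$ and $A$ be as in the context, and define for $0\le i<d$ $$m_i=\max_{i=i_1,i_2,\dots,i_k=0}\ \sum_{\ell=1}^{k-1}(-b_{i_{\ell+1}i_\ell}),$$ the maximum over all finite sequences of integers in $\{0,\dots,d-1\}$ with $i_1=i$ and $i_k=0$. Then $(m_1,\dots,m_{d-1})\in A$, and for every integral acceptable shifting $(a_1,\dots,a_{d-1})\in A\cap\mathbb Z^{d-1}$ one has $a_i\ge m_i$ for all $i$.
   Context: $N,M$ are positive integers, $d=\gcd(N,M)$. $\mathcal M_{N,M}$ is the set of $\Delta\subseteq\mathbb Z_{\ge0}$ with $\min\Delta=0$, $\Delta+N\subseteq\Delta$, $\Delta+M\subseteq\Delta$. The skeleton $S$ of $\Delta$ is the set of its $N$-generators (elements of $\Delta\setminus(\Delta+N)$) and $M$-cogenerators (elements of $(\Delta-M)\setminus\Delta$); $S_i=S\cap(d\mathbb Z+i)$. For $i\ne j$, $b_{ij}=\min\{y-x:x\in S_i,y\in S_j,y>x\}-1$, or $+\infty$ if no such pair exists. $A\subseteq\mathbb R^{d-1}$ is the set of $(a_1,\dots,a_{d-1})$ with $a_i-a_j\le b_{ij}$ for all $0\le i,j<d$, $i\ne j$, where $a_0:=0$. An acceptable shifting of $S$ is a tuple $(a_1,\dots,a_{d-1})$ for which there is a continuous $\phi:[0,1]\to\mathbb R^{d-1}$ from $0$ to $(a_1,\dots,a_{d-1})$ with $S_0,S_1+\phi_1(t),\dots,S_{d-1}+\phi_{d-1}(t)$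 pairwise disjoint for all $t$; the integral acceptable shiftings are exactly the points of $A\cap\mathbb Z^{d-1}$. -}

module Defs where

open import Data.Bool using (Bool; T)
open import Data.Nat as ℕ using (ℕ; zero; suc)
open import Data.Nat.GCD using (gcd)
open import Data.Integer as ℤ using (ℤ; +_; -[1+_]; _-_; _+_; -_)
open import Data.Integer.Divisibility using (_∣_)
open import Data.Maybe using (Maybe; just; nothing)
open import Data.List using (List; []; _∷_)
open import Data.Product using (Σ; ∃; _×_; _,_)
open import Data.Unit using (⊤)
open import Data.Empty using (⊥)
open import Relation.Nullary using (¬_)
open import Relation.Binary.PropositionalEquality using (_≡_; _≢_)

-- Δ ⊆ ℤ≥0 given as a (decidable) subset of ℕ, Δ n = true ↔ n ∈ Δ.
-- Membership of an arbitrary integer (negatives are never in Δ).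
InΔ : (ℕ → Bool) → ℤ → Set
InΔ Δ (+ n)    = T (Δ n)
InΔ Δ -[1+ n ] = ⊥

-- Δ ∈ 𝓜_{N,M}: min Δ = 0 (0 ∈ Δ, Δ ⊆ ℤ≥0 by typing), Δ+N ⊆ Δ, Δ+M ⊆ Δ.
InMNM : ℕ → ℕ → (ℕ → Bool) → Set
InMNM N M Δ = T (Δ 0)
            × (∀ n → T (Δ n) → T (Δ (n ℕ.+ N)))
            × (∀ n → T (Δ n) → T (Δ (n ℕ.+ M)))

NGen : ℕ → (ℕ → Bool) → ℤ → Set
NGen N Δ x = InΔ Δ x × ¬ InΔ Δ (x - + N)

MCogen : ℕ → (ℕ → Bool) → ℤ → Set
MCogen M Δ x = InΔ Δ (x + + M) × ¬ InΔ Δ x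

InS : ℕ → ℕ → (ℕ → Bool) → ℤ → Set
InS N M Δ x = (NGen N Δ x) Data.Sum.⊎ (MCogen M Δ x)
  where import Data.Sum

InSi : ℕ → ℕ → (ℕ → Bool) → ℕ → ℤ → Set
InSi N M Δ i x = InS N M Δ x × (+ (gcd N M) ∣ (x - + i))

-- Characterisation of b_ij ∈ ℤ ∪ {+∞} (nothing = +∞):
-- b_ij = min{ y - x : x ∈ S_i, y ∈ S_j, y > x } - 1, or +∞ if no such pair.
IsBij : ℕ → ℕ → (ℕ → Bool) → ℕ → ℕ → Maybe ℤ → Set
IsBij N M Δ i j (just v) =
    (Σ ℤ λ x → Σ ℤ λ y → InSi N M Δ i x × InSi N M Δ j y × x ℤ.< y
        × v ≡ y - x - + 1)
  × (∀ x y → InSi N M Δ i x → InSi N M Δ j y → x ℤ.< y → v ℤ.≤ y - x - + 1)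
IsBij N M Δ i j nothing =
  ∀ x y → InSi N M Δ i x → InSi N M Δ j y → x ℤ.< y → ⊥

IsB : ℕ → ℕ → (ℕ → Bool) → (ℕ → ℕ → Maybe ℤ) → Set
IsB N M Δ b = ∀ i j → i ℕ.< gcd N M → j ℕ.< gcd N M → i ≢ j
            → IsBij N M Δ i j (b i j)

-- Arithmetic in ℤ ∪ {-∞} (nothing = -∞)
_⊕_ : Maybe ℤ → Maybe ℤ → Maybe ℤ
just x ⊕ just y = just (x + y)
_ ⊕ _ = nothing

-- -b for b ∈ ℤ ∪ {+∞}, landing in ℤ ∪ {-∞}
negB : Maybe ℤ → Maybe ℤ
negB (just v) = just (- v)
negB nothing  = nothing

_≤⊥_ : Maybe ℤ → Maybe ℤ → Set
nothing ≤⊥ _      = ⊤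
just x ≤⊥ nothing = ⊥
just x ≤⊥ just y  = x ℤ.≤ y

-- A sequence i = i_1, i_2, …, i_k = 0 of indices in {0,…,d-1} is represented
-- by its start i and the list [i_2, …, i_k]; consecutive entries distinct.
WalkFrom : ℕ → ℕ → List ℕ → Set
WalkFrom d i []       = i ≡ 0
WalkFrom d i (j ∷ js) = i ≢ j × j ℕ.< d × WalkFrom d j js

weight : (ℕ → ℕ → Maybe ℤ) → ℕ → List ℕ → Maybe ℤ
weight b i []       = just (+ 0)
weight b i (j ∷ js) = negB (b j i) ⊕ weight b j js

IsMaxM : ℕ → (ℕ → ℕ → Maybe ℤ) → (ℕ → Maybe ℤ) → Set
IsMaxM d b m = ∀ i → i ℕ.< d →
    (∀ js → WalkFrom d i js → weight b i js ≤⊥ m i)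
  × (Σ (List ℕ) λ js → WalkFrom d i js × weight b i js ≡ m i)

-- the value at index i, with the convention a_0 := 0
val : (ℕ → Maybe ℤ) → ℕ → Maybe ℤ
val x zero    = just (+ 0)
val x (suc i) = x (suc i)

DiffLe : Maybe ℤ → Maybe ℤ → Maybe ℤ → Set
DiffLe _ _ nothing                = ⊤
DiffLe nothing _ (just v)         = ⊤
DiffLe (just p) nothing (just v)  = ⊥
DiffLe (just p) (just q) (just v) = p - q ℤ.≤ v

-- (x_1,…,x_{d-1}) ∈ A (entries at index 0 and ≥ d ignored; x_0 := 0)
InA : ℕ → (ℕ → ℕ → Maybe ℤ) → (ℕ → Maybe ℤ) → Set
InA d b x = ∀ i j → i ℕ.< d → j ℕ.< d → i ≢ j → DiffLe (val x i) (val x j) (b i j)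

-- A finite b_ij is min (y - x) - 1 over pairs x < y, hence nonnegative, so every step of a
-- walk has weight -b ≤ 0.  Cutting a walk at a repeated index therefore never lowers its
-- weight, and every walk is dominated by one without repetitions; there are finitely many
-- of those, so the maximum m_i exists.  Prepending j to an optimal walk from i gives
-- -b_ij + m_i ≤ m_j, i.e. m ∈ A.  Conversely, for a ∈ A each step satisfies
-- -b_{i_{ℓ+1} i_ℓ} ≤ a_{i_ℓ} - a_{i_{ℓ+1}}, so the weight of a walk from i telescopes to at
-- most a_i - a_0 = a_i.
module Submission where

open import Defs
open import Level using (0ℓ)
open import Data.Bool using (Bool)
open import Data.Unit using (tt)
open import Data.Maybe using (Maybe; just; nothing)
open import Data.Product using (Σ; _×_; _,_; proj₁; proj₂)
open import Data.Sum using (inj₁; inj₂)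
open import Function using (id; _⇔_; mk⇔; Equivalence)
open import Data.Nat.GCD using (gcd)
open import Data.Nat using (ℕ; zero; suc; z≤n; s≤s; s≤s⁻¹; _≤_; _<_; _≟_; _<?_)
import Data.Nat.Properties as ℕ
open import Data.Integer using (ℤ; 0ℤ; 1ℤ; _+_; _-_; -_)
import Data.Integer as ℤ using (_≤_)
import Data.Integer.Properties as ℤ
open import Data.Integer.Tactic.RingSolver using (solve-∀)
open import Data.List using (List; []; _∷_; length; filter; upTo; cartesianProductWith)
open import Data.List.Properties using (filter-all; filter-accept; filter-reject)
open import Data.List.Relation.Unary.All as All using (All; []; _∷_)
open import Data.List.Relation.Unary.All.Properties using (all-filter; ¬Any⇒All¬)
open import Data.List.Relation.Unary.Any using (here; there)
open import Data.List.Relation.Unary.AllPairs using ([]; _∷_)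
open import Data.List.Relation.Unary.Unique.Propositional using (Unique)
import Data.List.Relation.Unary.Unique.Propositional.Properties as Unique
open import Data.List.Membership.Propositional using (_∈_)
open import Data.List.Membership.Propositional.Properties
  using (∈-upTo⁺; ∈-filter⁺; ∈-cartesianProductWith⁺)
open import Data.List.Membership.DecPropositional _≟_ using (_∈?_)
import Data.List.Extrema as Extrema
open import Relation.Nullary using (Dec; yes; no; ¬?)
open import Relation.Nullary.Decidable using (_×-dec_)
open import Relation.Binary.Definitions using (Transitive; Antisymmetric; Total)
open import Relation.Binary.Structures using (IsTotalOrder)
open import Relation.Binary.Bundles using (TotalOrder)
open import Relation.Binary.PropositionalEquality
  using (_≡_; _≢_; refl; sym; trans; cong; subst; ≢-sym; isEquivalence)

≤⊥-refl : ∀ {x} → x ≤⊥ x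
≤⊥-refl {nothing} = tt
≤⊥-refl {just x}  = ℤ.≤-refl

≤⊥-trans : Transitive _≤⊥_
≤⊥-trans {nothing}                     _ _ = tt
≤⊥-trans {just x} {just y} {just z}    p q = ℤ.≤-trans p q
≤⊥-trans {just x} {nothing}            () _
≤⊥-trans {just x} {just y} {nothing}   _ ()

≤⊥-antisym : Antisymmetric _≡_ _≤⊥_
≤⊥-antisym {nothing} {nothing} _ _ = refl
≤⊥-antisym {just x}  {just y}  p q = cong just (ℤ.≤-antisym p q)
≤⊥-antisym {nothing} {just y}  _ ()
≤⊥-antisym {just x}  {nothing} () _

≤⊥-total : Total _≤⊥_
≤⊥-total nothing  y        = inj₁ tt
≤⊥-total (just x) nothing  = inj₂ tt
≤⊥-total (just x) (just y) = ℤ.≤-total x y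

≤⊥-isTotalOrder : IsTotalOrder _≡_ _≤⊥_
≤⊥-isTotalOrder = record
  { isPartialOrder = record
    { isPreorder = record
      { isEquivalence = isEquivalence
      ; reflexive     = λ { refl → ≤⊥-refl }
      ; trans         = ≤⊥-trans
      }
    ; antisym = ≤⊥-antisym
    }
  ; total = ≤⊥-total
  }

≤⊥-totalOrder : TotalOrder 0ℓ 0ℓ 0ℓ
≤⊥-totalOrder = record { isTotalOrder = ≤⊥-isTotalOrder }

open Extrema ≤⊥-totalOrder using (argmax; argmax-all; f[xs]≤f[argmax])

⊕-monoʳ-≤⊥ : ∀ x {y z} → y ≤⊥ z → (x ⊕ y) ≤⊥ (x ⊕ z)
⊕-monoʳ-≤⊥ nothing                     _   = tt
⊕-monoʳ-≤⊥ (just x) {nothing}           _   = tt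
⊕-monoʳ-≤⊥ (just x) {just y} {just z}   y≤z = ℤ.+-monoʳ-≤ x y≤z
⊕-monoʳ-≤⊥ (just x) {just y} {nothing}  ()

x≤0⇒x⊕y≤y : ∀ {x} y → x ≤⊥ just 0ℤ → (x ⊕ y) ≤⊥ y
x≤0⇒x⊕y≤y {nothing} _        _   = tt
x≤0⇒x⊕y≤y {just x}  nothing  _   = tt
x≤0⇒x⊕y≤y {just x}  (just y) x≤0 =
  subst (x + y ℤ.≤_) (ℤ.+-identityˡ y) (ℤ.+-monoˡ-≤ y x≤0)

p-q-v≡-v+p-q : ∀ p q v → p - q - v ≡ - v + p - q
p-q-v≡-v+p-q = solve-∀

p-q≤v⇔-v+p≤q : ∀ p q v → (p - q ℤ.≤ v) ⇔ (- v + p ℤ.≤ q)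
p-q≤v⇔-v+p≤q p q v = mk⇔
  (λ h → ℤ.i-j≤0⇒i≤j (subst (ℤ._≤ 0ℤ) (p-q-v≡-v+p-q p q v) (ℤ.i≤j⇒i-j≤0 h)))
  (λ h → ℤ.i-j≤0⇒i≤j (subst (ℤ._≤ 0ℤ) (sym (p-q-v≡-v+p-q p q v)) (ℤ.i≤j⇒i-j≤0 h)))

DiffLe⇒negB⊕≤⊥ : ∀ c p {q} → DiffLe p q c → (negB c ⊕ p) ≤⊥ q
DiffLe⇒negB⊕≤⊥ nothing  _                   _ = tt
DiffLe⇒negB⊕≤⊥ (just v) nothing            _ = tt
DiffLe⇒negB⊕≤⊥ (just v) (just p) {just q}  h = Equivalence.to (p-q≤v⇔-v+p≤q p q v) h

negB⊕≤⊥⇒DiffLe : ∀ c p {q} → (negB c ⊕ p) ≤⊥ q → DiffLe p q c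
negB⊕≤⊥⇒DiffLe nothing  _                   _ = tt
negB⊕≤⊥⇒DiffLe (just v) nothing            _ = tt
negB⊕≤⊥⇒DiffLe (just v) (just p) {just q}  h = Equivalence.from (p-q≤v⇔-v+p≤q p q v) h

length-unique≤ : ∀ d {xs} → Unique xs → All (_< d) xs → length xs ≤ d
length-unique≤ zero    {[]}    _ _        = z≤n
length-unique≤ zero    {_ ∷ _} _ (() ∷ _)
length-unique≤ (suc c) {xs}    u xs<1+c   = ℕ.≤-trans (length≤1+|xs<c| u xs<1+c)
  (s≤s (length-unique≤ c (Unique.filter⁺ (_<? c) u) (all-filter (_<? c) xs)))
  where
  length≤1+|xs<c| : ∀ {xs} → Unique xs → All (_< suc c) xs
                  → length xs ≤ suc (length (filter (_<? c) xs))
  length≤1+|xs<c| []           []              = z≤n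
  length≤1+|xs<c| {x ∷ xs} (x∉xs ∷ u) (x<1+c ∷ xs<1+c) with x <? c
  ... | yes x<c rewrite filter-accept (_<? c) {xs = xs} x<c = s≤s (length≤1+|xs<c| u xs<1+c)
  ... | no x≮c rewrite filter-reject (_<? c) {xs = xs} x≮c =
    s≤s (ℕ.≤-reflexive (sym (cong length (filter-all (_<? c) xs<c))))
    where
    x≡c : x ≡ c
    x≡c = ℕ.≤-antisym (s≤s⁻¹ x<1+c) (ℕ.≮⇒≥ x≮c)
    xs<c : All (_< c) xs
    xs<c = All.zipWith (λ (y<1+c , x≢y) → ℕ.≤∧≢⇒< (s≤s⁻¹ y<1+c) (λ y≡c → x≢y (trans x≡c (sym y≡c))))
                       (xs<1+c , x∉xs)

boundedLists : ℕ → ℕ → List (List ℕ)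
boundedLists d zero    = [] ∷ []
boundedLists d (suc K) = [] ∷ cartesianProductWith _∷_ (upTo d) (boundedLists d K)

∈-boundedLists : ∀ {d} K {xs} → All (_< d) xs → length xs ≤ K → xs ∈ boundedLists d K
∈-boundedLists zero    {[]}     _             _       = here refl
∈-boundedLists (suc K) {[]}     _             _       = here refl
∈-boundedLists (suc K) {x ∷ xs} (x<d ∷ xs<d) (s≤s l) =
  there (∈-cartesianProductWith⁺ _∷_ (∈-upTo⁺ x<d) (∈-boundedLists K xs<d l))

walk? : ∀ d k js → Dec (WalkFrom d k js)
walk? d k []       = k ≟ 0
walk? d k (j ∷ js) = ¬? (k ≟ j) ×-dec (j <? d ×-dec walk? d j js)

walk⇒All< : ∀ {d k} js → WalkFrom d k js → All (_< d) js
walk⇒All< []       _               = []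
walk⇒All< (j ∷ js) (_ , j<d , walk) = j<d ∷ walk⇒All< js walk

weight≤val : ∀ {d b x} → InA d b x → ∀ {k} js → k < d → WalkFrom d k js → weight b k js ≤⊥ val x k
weight≤val x∈A []                 _   refl = ℤ.≤-refl
weight≤val {b = b} {x} x∈A {k} (j ∷ js) k<d (k≢j , j<d , walk) = ≤⊥-trans
  (⊕-monoʳ-≤⊥ (negB (b j k)) (weight≤val x∈A js j<d walk))
  (DiffLe⇒negB⊕≤⊥ (b j k) (val x j) (x∈A j k j<d k<d (≢-sym k≢j)))

y-[1+x]≡y-x-1 : ∀ x y → y - (1ℤ + x) ≡ y - x - 1ℤ
y-[1+x]≡y-x-1 = solve-∀

NonnegativeB : ℕ → (ℕ → ℕ → Maybe ℤ) → Set
NonnegativeB d b = ∀ i j → i < d → j < d → i ≢ j → negB (b i j) ≤⊥ just 0ℤ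

b-nonnegative : ∀ {N M Δ b} → IsB N M Δ b → NonnegativeB (gcd N M) b
b-nonnegative {b = b} b-isB i j i<d j<d i≢j with b i j | b-isB i j i<d j<d i≢j
... | nothing | _                                = tt
... | just v  | (x , y , _ , _ , x<y , refl) , _ = ℤ.neg-mono-≤ 0≤y-x-1
  where
  0≤y-x-1 : 0ℤ ℤ.≤ y - x - ℤ.+ 1
  0≤y-x-1 = subst (0ℤ ℤ.≤_) (y-[1+x]≡y-x-1 x y) (ℤ.i≤j⇒0≤j-i (ℤ.i<j⇒suc[i]≤j x<y))

module OptimalWalks {d : ℕ} {b : ℕ → ℕ → Maybe ℤ} (b≥0 : NonnegativeB d b) where

  step≤ : ∀ {k j} → k < d → j < d → k ≢ j → ∀ w → (negB (b j k) ⊕ w) ≤⊥ w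
  step≤ k<d j<d k≢j w = x≤0⇒x⊕y≤y w (b≥0 _ _ j<d k<d (≢-sym k≢j))

  weight≤0 : ∀ {k} js → k < d → WalkFrom d k js → weight b k js ≤⊥ just 0ℤ
  weight≤0 []       _   refl               = ℤ.≤-refl
  weight≤0 (j ∷ js) k<d (k≢j , j<d , walk) =
    ≤⊥-trans (step≤ k<d j<d k≢j _) (weight≤0 js j<d walk)

  dropThrough : ∀ {u v} js → u < d → v ∈ js → WalkFrom d u js
    → Σ (List ℕ) λ ys → WalkFrom d v ys × weight b u js ≤⊥ weight b v ys
                      × (Unique js → Unique (v ∷ ys))
  dropThrough (j ∷ js) u<d (here refl) (u≢j , j<d , walk) =
    js , walk , step≤ u<d j<d u≢j _ , id
  dropThrough (j ∷ js) u<d (there v∈js) (u≢j , j<d , walk)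
    with ys , walk′ , le , unique ← dropThrough js j<d v∈js walk =
    ys , walk′ , ≤⊥-trans (step≤ u<d j<d u≢j _) le , λ { (_ ∷ u) → unique u }

  eraseLoops : ∀ {k} js → k < d → WalkFrom d k js
    → Σ (List ℕ) λ ys → WalkFrom d k ys × Unique (k ∷ ys) × weight b k js ≤⊥ weight b k ys
  eraseLoops []       _   walk = [] , walk , [] ∷ [] , ≤⊥-refl
  eraseLoops {k} (j ∷ js) k<d (k≢j , j<d , walk)
    with ys , walk′ , unique , le ← eraseLoops js j<d walk
    with k ∈? j ∷ ys
  ... | yes k∈ with zs , walk″ , le′ , unique′ ← dropThrough (j ∷ ys) k<d k∈ (k≢j , j<d , walk′) =
    zs , walk″ , unique′ unique , ≤⊥-trans (⊕-monoʳ-≤⊥ (negB (b j k)) le) le′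
  ... | no k∉ =
    j ∷ ys , (k≢j , j<d , walk′) , ¬Any⇒All¬ (j ∷ ys) k∉ ∷ unique , ⊕-monoʳ-≤⊥ (negB (b j k)) le

  trivialWalk : ℕ → List ℕ
  trivialWalk zero    = []
  trivialWalk (suc _) = 0 ∷ []

  trivialWalk-isWalk : ∀ {k} → k < d → WalkFrom d k (trivialWalk k)
  trivialWalk-isWalk {zero}  _   = refl
  trivialWalk-isWalk {suc k} k<d = (λ ()) , ℕ.≤-trans (s≤s z≤n) k<d , refl

  candidates : ℕ → List (List ℕ)
  candidates k = filter (walk? d k) (boundedLists d d)

  bestWalk : ℕ → List ℕ
  bestWalk k = argmax (weight b k) (trivialWalk k) (candidates k)

  bestWalk-isWalk : ∀ {k} → k < d → WalkFrom d k (bestWalk k)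
  bestWalk-isWalk {k} k<d =
    argmax-all (weight b k) (trivialWalk-isWalk k<d) (all-filter (walk? d k) (boundedLists d d))

  weight≤bestWalk : ∀ {k} js → k < d → WalkFrom d k js → weight b k js ≤⊥ weight b k (bestWalk k)
  weight≤bestWalk {k} js k<d walk
    with ys , walk′ , unique , le ← eraseLoops js k<d walk =
    ≤⊥-trans le (All.lookup (f[xs]≤f[argmax] {f = weight b k} (trivialWalk k) (candidates k)) ys∈candidates)
    where
    ys∈candidates : ys ∈ candidates k
    ys∈candidates = ∈-filter⁺ (walk? d k)
      (∈-boundedLists d (walk⇒All< ys walk′)
        (ℕ.<⇒≤ (length-unique≤ d unique (k<d ∷ walk⇒All< ys walk′))))
      walk′

  m : ℕ → Maybe ℤ
  m zero    = just 0ℤ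
  m (suc k) = weight b (suc k) (bestWalk (suc k))

  m-isMax : IsMaxM d b m
  m-isMax zero    0<d = (λ js → weight≤0 js 0<d) , [] , refl , refl
  m-isMax (suc k) k<d = (λ js → weight≤bestWalk js k<d) , bestWalk (suc k) , bestWalk-isWalk k<d , refl

  val-m : ∀ k → val m k ≡ m k
  val-m zero    = refl
  val-m (suc k) = refl

  m∈A : InA d b m
  m∈A i j i<d j<d i≢j
    rewrite val-m i | val-m j
    with ws , walk , weight≡m ← proj₂ (m-isMax i i<d) =
    negB⊕≤⊥⇒DiffLe (b i j) (m i)
      (subst (λ w → (negB (b i j) ⊕ w) ≤⊥ m j) weight≡m
        (proj₁ (m-isMax j j<d) (i ∷ ws) (≢-sym i≢j , i<d , walk)))

  m≤a : (a : ℕ → ℤ) → InA d b (λ i → just (a i)) → ∀ i → 0 < i → i < d → m i ≤⊥ just (a i)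
  m≤a a a∈A (suc i) _ i<d = weight≤val a∈A (bestWalk (suc i)) i<d (bestWalk-isWalk i<d)

mainTheorem9 : (N M : ℕ) → 0 < N → 0 < M → (Δ : ℕ → Bool) → InMNM N M Δ
    → (b : ℕ → ℕ → Maybe ℤ) → IsB N M Δ b
    → Σ (ℕ → Maybe ℤ) λ m → IsMaxM (gcd N M) b m
        × InA (gcd N M) b m
        × ((a : ℕ → ℤ) → InA (gcd N M) b (λ i → just (a i))
           → ∀ i → 0 < i → i < gcd N M → m i ≤⊥ just (a i))
mainTheorem9 N M _ _ Δ _ b b-isB = m , m-isMax , m∈A , m≤a
  where open OptimalWalks (b-nonnegative {N} {M} {Δ} b-isB)
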